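{- Let $\Delta$ be a pure simplicial complex on vertex set $[n]$ with codimension $c=n-\dim\Delta-1$. If $\dim\Delta\ge 1$, $c\ge 2$ and $\overline{e}(\Delta)\le 2c-1$, then $\Delta$ has at least two vertices $v$ each of which avoids at most $2c-3$ antifacets, i.e. for each such $v$ the number of antifacets $F$ of $\Delta$ with $v\notin F$ is at most $2c-3$.
   Context: A simplicial complex on vertex set $[n]$ contains $\{i\}$ as a face for every $i\in[n]$. $\Delta$ is pure if all facets have the same cardinality; $\dim F=|F|-1$. An antifacet of $\Delta$ is a subset of $[n]$ of cardinality $\dim\Delta+1$ that is not a face of $\Delta$. $\overline{e}(\Delta)$ denotes the number of antifacets of $\Delta$, so $\overline{e}(\Delta)=\binom{n}{c}-e(\Delta)$ where $e(\Delta)$ is the number of facets. -}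

module Defs where

open import Data.Nat using (ℕ; zero; suc; _≤_)
open import Data.Bool using (Bool; true; false)
open import Data.Fin using (Fin)
open import Data.Fin.Subset using (Subset; _⊆_; _⊂_; ⁅_⁆; ∣_∣; _∈_; _∉_)
open import Data.Vec using (Vec; []; _∷_)
open import Data.List using (List; []; _∷_; map; _++_; length; filter)
open import Data.Product using (Σ; _×_)
open import Relation.Nullary using (¬_; Dec)
open import Relation.Nullary.Decidable using (_×-dec_; ¬?)
open import Data.Fin.Subset.Properties using (_∈?_)
import Data.Nat as ℕ
open import Relation.Unary using (Pred; Decidable)
open import Relation.Binary.PropositionalEquality using (_≡_)
open import Level using (0ℓ)

record SimplicialComplex (n : ℕ) : Set₁ where
  field
    IsFace     : Subset n → Set
    isFace?    : (F : Subset n) → Dec (IsFace F)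
    down-closed : ∀ {F G} → G ⊆ F → IsFace F → IsFace G
    singletons : ∀ (i : Fin n) → IsFace ⁅ i ⁆
open SimplicialComplex public

module _ {n : ℕ} (Δ : SimplicialComplex n) where

  IsFacet : Subset n → Set
  IsFacet F = IsFace Δ F × (∀ G → F ⊂ G → ¬ IsFace Δ G)

  HasDimPlusOne : ℕ → Set
  HasDimPlusOne k = Σ (Subset n) (λ F → IsFace Δ F × ∣ F ∣ ≡ k)
                    × (∀ F → IsFace Δ F → ∣ F ∣ ≤ k)

  Pure : Set
  Pure = ∀ F G → IsFacet F → IsFacet G → ∣ F ∣ ≡ ∣ G ∣

allSubsets : (n : ℕ) → List (Subset n)
allSubsets zero = [] ∷ []
allSubsets (suc n) = map (false ∷_) (allSubsets n) ++ map (true ∷_) (allSubsets n)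

module _ {n : ℕ} (Δ : SimplicialComplex n) where

  IsAntifacet : ℕ → Subset n → Set
  IsAntifacet k F = ∣ F ∣ ≡ k × ¬ IsFace Δ F

  IsAntifacetAvoiding : ℕ → Fin n → Subset n → Set
  IsAntifacetAvoiding k v F = IsAntifacet k F × v ∉ F

  isAntifacet? : (k : ℕ) → Decidable (IsAntifacet k)
  isAntifacet? k F = (∣ F ∣ ℕ.≟ k) ×-dec ¬? (isFace? Δ F)

  isAntifacetAvoiding? : (k : ℕ) (v : Fin n) → Decidable (IsAntifacetAvoiding k v)
  isAntifacetAvoiding? k v F = isAntifacet? k F ×-dec ¬? (v ∈? F)

  antifacetCount : ℕ → ℕ
  antifacetCount k = length (filter (isAntifacet? k) (allSubsets n))

  avoidingCount : ℕ → Fin n → ℕ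
  avoidingCount k v = length (filter (isAntifacetAvoiding? k v) (allSubsets n))

-- Double counting the pairs (antifacet F, vertex v ∉ F) gives Σ_v ā(v) = ē·c ≤ (2c − 1)c,
-- where ā(v) is the number of antifacets avoiding v. If all vertices but possibly one
-- avoided at least 2c − 2 antifacets, the sum would be at least (n − 1)(2c − 2) with
-- n = dim Δ + 1 + c ≥ c + 2, which exceeds (2c − 1)c unless n = 4, c = 2 and the exceptional
-- vertex v avoids no antifacet. Then Δ is a graph on four vertices v, x, u, y in which every
-- non-edge contains v. By purity v is not isolated, say vx is an edge; then the only possible
-- antifacet avoiding u is vy, contradicting ā(u) ≥ 2.
module Submission where

open import Defs
open import Data.Nat using (ℕ; _≤_; _+_; _*_; _∸_)
open import Data.Fin using (Fin)
open import Data.Product using (Σ; _×_)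
open import Relation.Binary.PropositionalEquality using (_≢_)

open import Data.Nat.Properties
open import Algebra.Properties.CommutativeMonoid.Sum +-0-commutativeMonoid
  using (sum; sum-remove; sum-cong-≗; sum-replicate-zero; ∑-distrib-+)
open import Data.Bool using (true; false; if_then_else_) renaming (_≟_ to _≟ᵇ_)
open import Data.Fin using (zero; suc; punchIn)
open import Data.Fin.Patterns using (0F; 1F; 2F; 3F)
open import Data.Fin.Properties using (any?; punchInᵢ≢i) renaming (_≟_ to _≟ᶠ_)
open import Data.Fin.Subset using (Subset; ⁅_⁆; ∣_∣; _∪_; _∈_; _∉_; _⊆_)
open import Data.Fin.Subset.Properties
  using (_∈?_; x∈p∪q⁻; x∈⁅x⁆; x∈⁅y⁆⇒x≡y; x∉⁅y⁆⇒x≢y; ∣⁅x⁆∣≡1; p⊂q⇒∣p∣<∣q∣)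
open import Data.Vec using ([]; _∷_)
open import Data.Vec.Properties using (≡-dec)
open import Data.List using (List; []; _∷_; length; filter; map; _++_)
import Data.List.Membership.Propositional as List
open import Data.List.Membership.Propositional.Properties
  using (∈-filter⁺; ∈-length; ∈-map⁺; ∈-++⁺ˡ; ∈-++⁺ʳ)
open import Data.List.Relation.Binary.Sublist.Heterogeneous.Properties using (length-mono-≤)
open import Data.List.Relation.Binary.Sublist.Propositional using (⊆-refl)
open import Data.List.Relation.Binary.Sublist.Propositional.Properties using (filter⁺)
open import Data.List.Relation.Unary.Any using (here)
open import Data.Nat using (zero; suc; _<_; z≤n; _≟_; _≤?_)
open import Data.Nat.Tactic.RingSolver using (solve-∀)
open import Data.Product using (_,_; proj₁)
open import Data.Sum using (_⊎_; inj₁; inj₂)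
open import Level using (0ℓ)
open import Relation.Binary.PropositionalEquality
  using (_≡_; refl; sym; trans; cong; cong₂; subst; module ≡-Reasoning)
open import Relation.Nullary using (¬_; Dec; yes; no; does; contradiction)
open import Relation.Nullary.Decidable using (_×-dec_; ¬?)
open import Relation.Unary using (Pred; Decidable)

private
  variable
    n k : ℕ
    A : Set

indicator : Dec A → ℕ
indicator d = if does d then 1 else 0

module _ {A : Set} {P : Pred A 0ℓ} (P? : Decidable P) where

  length-filter-∷ : ∀ x xs → length (filter P? (x ∷ xs)) ≡ indicator (P? x) + length (filter P? xs)
  length-filter-∷ x xs with does (P? x)
  ... | true  = refl
  ... | false = refl

  length-filter-mono : ∀ {Q : Pred A 0ℓ} (Q? : Decidable Q) → (∀ {x} → P x → Q x) →
                       ∀ xs → length (filter P? xs) ≤ length (filter Q? xs)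
  length-filter-mono Q? P⇒Q xs = length-mono-≤ (filter⁺ P? Q? (λ { refl → P⇒Q }) (⊆-refl {x = xs}))

  length-filter≡0⇒¬ : ∀ {x xs} → x List.∈ xs → length (filter P? xs) ≡ 0 → ¬ P x
  length-filter≡0⇒¬ x∈xs ≡0 px = <⇒≢ (∈-length (∈-filter⁺ P? x∈xs px)) (sym ≡0)

∈-allSubsets : (F : Subset n) → F List.∈ allSubsets n
∈-allSubsets []          = here refl
∈-allSubsets {suc n} (false ∷ F) = ∈-++⁺ˡ (∈-map⁺ (false ∷_) (∈-allSubsets F))
∈-allSubsets {suc n} (true ∷ F)  =
  ∈-++⁺ʳ (map (false ∷_) (allSubsets n)) (∈-map⁺ (true ∷_) (∈-allSubsets F))

n*m≤sum : ∀ {m} (f : Fin n → ℕ) → (∀ i → m ≤ f i) → n * m ≤ sum f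
n*m≤sum {zero}  f m≤f = z≤n
n*m≤sum {suc n} f m≤f = +-mono-≤ (m≤f zero) (n*m≤sum (λ i → f (suc i)) (λ i → m≤f (suc i)))

f[v]+n*m≤sum : ∀ {n m} (f : Fin (suc n) → ℕ) v → (∀ w → w ≢ v → m ≤ f w) → f v + n * m ≤ sum f
f[v]+n*m≤sum {n} f v m≤f = begin
  f v + n * _                       ≤⟨ +-monoʳ-≤ (f v) (n*m≤sum _ (λ i → m≤f _ (punchInᵢ≢i v i))) ⟩
  f v + sum (λ i → f (punchIn v i)) ≡⟨ sym (sum-remove {i = v} f) ⟩
  sum f                             ∎
  where open ≤-Reasoning

TwoAtMost : (Fin n → ℕ) → ℕ → Set
TwoAtMost {n} f b = Σ (Fin n) λ v → Σ (Fin n) λ w → v ≢ w × f v ≤ b × f w ≤ b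

AboveExceptAt : (Fin n → ℕ) → ℕ → Fin n → Set
AboveExceptAt f b v = ∀ w → w ≢ v → b < f w

twoAtMost⊎aboveExceptOne : (f : Fin (suc n) → ℕ) (b : ℕ) →
                             TwoAtMost f b ⊎ Σ (Fin (suc n)) (AboveExceptAt f b)
twoAtMost⊎aboveExceptOne f b with any? (λ v → f v ≤? b)
... | no none = inj₂ (zero , λ w _ → ≰⇒> (λ fw≤b → none (w , fw≤b)))
... | yes (v , fv≤b) with any? (λ w → ¬? (w ≟ᶠ v) ×-dec f w ≤? b)
...   | yes (w , w≢v , fw≤b) = inj₁ (v , w , (λ v≡w → w≢v (sym v≡w)) , fv≤b , fw≤b)
...   | no noOther = inj₂ (v , λ w w≢v → ≰⇒> (λ fw≤b → noOther (w , w≢v , fw≤b)))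

sum-∉+∣F∣≡n : (F : Subset n) → sum (λ v → indicator (¬? (v ∈? F))) + ∣ F ∣ ≡ n
sum-∉+∣F∣≡n []          = refl
sum-∉+∣F∣≡n (false ∷ F) = cong suc (sum-∉+∣F∣≡n F)
sum-∉+∣F∣≡n (true ∷ F)  = trans (+-suc _ ∣ F ∣) (cong suc (sum-∉+∣F∣≡n F))

sum-indicator-×-∉ : (a : Dec A) (F : Subset n) → (A → ∣ F ∣ ≡ k) →
                    sum (λ v → indicator (a ×-dec ¬? (v ∈? F))) ≡ indicator a * (n ∸ k)
sum-indicator-×-∉ {n = n} {k = k} (yes a) F ∣F∣≡k = begin
  sum (λ v → indicator (¬? (v ∈? F)))                 ≡⟨ m+n∸n≡m _ ∣ F ∣ ⟨
  sum (λ v → indicator (¬? (v ∈? F))) + ∣ F ∣ ∸ ∣ F ∣ ≡⟨ cong₂ _∸_ (sum-∉+∣F∣≡n F) (∣F∣≡k a) ⟩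
  n ∸ k                                               ≡⟨ *-identityˡ (n ∸ k) ⟨
  1 * (n ∸ k)                                         ∎
  where open ≡-Reasoning
sum-indicator-×-∉ {n = n} (no _) F _ = sum-replicate-zero n

module _ (Δ : SimplicialComplex n) (k : ℕ) where

  sum-length-filter-avoiding : (Fs : List (Subset n)) →
    sum (λ v → length (filter (isAntifacetAvoiding? Δ k v) Fs))
      ≡ length (filter (isAntifacet? Δ k) Fs) * (n ∸ k)
  sum-length-filter-avoiding []       = sum-replicate-zero n
  sum-length-filter-avoiding (F ∷ Fs) = begin
    sum (λ v → length (filter (avoiding? v) (F ∷ Fs)))
      ≡⟨ sum-cong-≗ (λ v → length-filter-∷ (avoiding? v) F Fs) ⟩
    sum (λ v → indicator (avoiding? v F) + length (filter (avoiding? v) Fs))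
      ≡⟨ ∑-distrib-+ (λ v → indicator (avoiding? v F)) (λ v → length (filter (avoiding? v) Fs)) ⟩
    sum (λ v → indicator (avoiding? v F)) + sum (λ v → length (filter (avoiding? v) Fs))
      ≡⟨ cong₂ _+_ (sum-indicator-×-∉ (isAntifacet? Δ k F) F proj₁) (sum-length-filter-avoiding Fs) ⟩
    indicator (isAntifacet? Δ k F) * (n ∸ k) + length (filter (isAntifacet? Δ k) Fs) * (n ∸ k)
      ≡⟨ *-distribʳ-+ (n ∸ k) (indicator (isAntifacet? Δ k F)) _ ⟨
    (indicator (isAntifacet? Δ k F) + length (filter (isAntifacet? Δ k) Fs)) * (n ∸ k)
      ≡⟨ cong (_* (n ∸ k)) (length-filter-∷ (isAntifacet? Δ k) F Fs) ⟨
    length (filter (isAntifacet? Δ k) (F ∷ Fs)) * (n ∸ k)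
      ∎
    where
    open ≡-Reasoning
    avoiding? = isAntifacetAvoiding? Δ k

  sum-avoidingCount : sum (avoidingCount Δ k) ≡ antifacetCount Δ k * (n ∸ k)
  sum-avoidingCount = sum-length-filter-avoiding (allSubsets n)

private
  2[2+d]∸1 : ∀ d → 2 * (2 + d) ∸ 1 ≡ 3 + 2 * d
  2[2+d]∸1 d = trans (cong (_∸ 1) (expand d)) (m+n∸m≡n 1 (3 + 2 * d))
    where
    expand : ∀ d → 2 * (2 + d) ≡ 1 + (3 + 2 * d)
    expand = solve-∀

  2[2+d]∸3 : ∀ d → 2 * (2 + d) ∸ 3 ≡ 1 + 2 * d
  2[2+d]∸3 d = trans (cong (_∸ 3) (expand d)) (m+n∸m≡n 3 (1 + 2 * d))
    where
    expand : ∀ d → 2 * (2 + d) ≡ 3 + (1 + 2 * d)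
    expand = solve-∀

  -- 1 + e + (2 + d) is how (2 + e) + (2 + d) ∸ 1 normalises.
  excess-identity : ∀ d e x →
    x + (1 + e + (2 + d)) * (2 + 2 * d) ≡ (3 + 2 * d) * (2 + d) + (x + (d + (e + e * (1 + 2 * d))))
  excess-identity = solve-∀

  excess≡0 : ∀ {a} d e x → a ≤ 2 * (2 + d) ∸ 1 →
    x + (1 + e + (2 + d)) * suc (2 * (2 + d) ∸ 3) ≤ a * (2 + d) →
    x + (d + (e + e * (1 + 2 * d))) ≡ 0
  excess≡0 {a} d e x a≤ bound = n≤0⇒n≡0 (+-cancelˡ-≤ ((3 + 2 * d) * (2 + d)) _ 0 (begin
    (3 + 2 * d) * (2 + d) + _                     ≡⟨ excess-identity d e x ⟨
    x + (1 + e + (2 + d)) * (2 + 2 * d)           ≡⟨ cong (λ b → x + (1 + e + (2 + d)) * suc b) (2[2+d]∸3 d) ⟨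
    x + (1 + e + (2 + d)) * suc (2 * (2 + d) ∸ 3) ≤⟨ bound ⟩
    a * (2 + d)                                   ≤⟨ *-monoˡ-≤ (2 + d) (subst (a ≤_) (2[2+d]∸1 d) a≤) ⟩
    (3 + 2 * d) * (2 + d)                         ≡⟨ +-identityʳ _ ⟨
    (3 + 2 * d) * (2 + d) + 0                     ∎))
    where open ≤-Reasoning

  tight-parameters : ∀ {n k c a x} d e → k ≡ 2 + e → c ≡ 2 + d → n ≡ k + c →
    a ≤ 2 * c ∸ 1 → x + (n ∸ 1) * suc (2 * c ∸ 3) ≤ a * c → n ≡ 4 × k ≡ 2 × x ≡ 0
  tight-parameters {x = x} d e refl refl refl a≤ bound
    with x+⋯≡0 ← excess≡0 d e x a≤ bound
    with refl ← m+n≡0⇒m≡0 d (m+n≡0⇒n≡0 x x+⋯≡0)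
    with refl ← m+n≡0⇒m≡0 e (m+n≡0⇒n≡0 x x+⋯≡0)
    = refl , refl , m+n≡0⇒m≡0 x x+⋯≡0

tight-counting⇒n≡4∧k≡2 : ∀ {n k a x} → 2 ≤ k → 2 ≤ n ∸ k → a ≤ 2 * (n ∸ k) ∸ 1 →
  x + (n ∸ 1) * suc (2 * (n ∸ k) ∸ 3) ≤ a * (n ∸ k) → n ≡ 4 × k ≡ 2 × x ≡ 0
tight-counting⇒n≡4∧k≡2 {n} {k} 2≤k 2≤c = tight-parameters (n ∸ k ∸ 2) (k ∸ 2)
  (sym (m+[n∸m]≡n 2≤k)) (sym (m+[n∸m]≡n 2≤c)) (sym (m+[n∸m]≡n k≤n))
  where
  k≤n : k ≤ n
  k≤n = <⇒≤ (m∸n≢0⇒n<m (λ c≡0 → contradiction (subst (2 ≤_) c≡0 2≤c) λ ()))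

⁅x⁆∪⁅y⁆⊆p : ∀ {x y} {p : Subset n} → x ∈ p → y ∈ p → ⁅ x ⁆ ∪ ⁅ y ⁆ ⊆ p
⁅x⁆∪⁅y⁆⊆p {x = x} {y} x∈p y∈p z∈ with x∈p∪q⁻ ⁅ x ⁆ ⁅ y ⁆ z∈
... | inj₁ z∈⁅x⁆ rewrite x∈⁅y⁆⇒x≡y x z∈⁅x⁆ = x∈p
... | inj₂ z∈⁅y⁆ rewrite x∈⁅y⁆⇒x≡y y z∈⁅y⁆ = y∈p

module _ (Δ : SimplicialComplex n) where

  maximum-face⇒isFacet : ∀ {F} → (∀ G → IsFace Δ G → ∣ G ∣ ≤ k) → IsFace Δ F → ∣ F ∣ ≡ k → IsFacet Δ F
  maximum-face⇒isFacet max F-face ∣F∣≡k = F-face , λ G F⊂G G-face →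
    <⇒≱ (subst (_< ∣ G ∣) ∣F∣≡k (p⊂q⇒∣p∣<∣q∣ F⊂G)) (max G G-face)

  no-edge-at⇒singleton-isFacet : ∀ v → (∀ x → v ≢ x → ¬ IsFace Δ (⁅ v ⁆ ∪ ⁅ x ⁆)) → IsFacet Δ ⁅ v ⁆
  no-edge-at⇒singleton-isFacet v no-edge = singletons Δ v , λ { G (⁅v⁆⊆G , x , x∈G , x∉⁅v⁆) G-face →
    no-edge x (λ v≡x → x∉⁅y⁆⇒x≢y x∉⁅v⁆ (sym v≡x))
      (down-closed Δ (⁅x⁆∪⁅y⁆⊆p (⁅v⁆⊆G (x∈⁅x⁆ v)) x∈G) G-face) }

  pure⇒edge-at : HasDimPlusOne Δ k → Pure Δ → 2 ≤ k →
                 ∀ v → Σ (Fin n) λ x → v ≢ x × IsFace Δ (⁅ v ⁆ ∪ ⁅ x ⁆)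
  pure⇒edge-at {k} ((F , F-face , ∣F∣≡k) , max) pure 2≤k v
    with any? (λ x → ¬? (v ≟ᶠ x) ×-dec isFace? Δ (⁅ v ⁆ ∪ ⁅ x ⁆))
  ... | yes edge   = edge
  ... | no no-edge = contradiction (begin
    1         ≡⟨ ∣⁅x⁆∣≡1 v ⟨
    ∣ ⁅ v ⁆ ∣ ≡⟨ pure ⁅ v ⁆ F (no-edge-at⇒singleton-isFacet v λ x v≢x edge → no-edge (x , v≢x , edge))
                              (maximum-face⇒isFacet max F-face ∣F∣≡k) ⟩
    ∣ F ∣     ≡⟨ ∣F∣≡k ⟩
    k         ∎) (<⇒≢ 2≤k)
    where open ≡-Reasoning

OtherPairThrough : Fin n → Fin n → Fin n → Subset n → Set
OtherPairThrough v x u F = ∣ F ∣ ≡ 2 × v ∈ F × u ∉ F × F ≢ ⁅ v ⁆ ∪ ⁅ x ⁆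

otherPairThrough? : (v x u : Fin n) → Decidable (OtherPairThrough v x u)
otherPairThrough? v x u F =
  (∣ F ∣ ≟ 2) ×-dec (v ∈? F) ×-dec ¬? (u ∈? F) ×-dec ¬? (≡-dec _≟ᵇ_ F (⁅ v ⁆ ∪ ⁅ x ⁆))

-- u is a vertex outside {v, x}; each count is settled by normalisation.
third-vertex : (v x : Fin 4) → v ≢ x →
  Σ (Fin 4) λ u → u ≢ v × length (filter (otherPairThrough? v x u) (allSubsets 4)) ≤ 1
third-vertex 0F 0F v≢x = contradiction refl v≢x
third-vertex 0F 1F _   = 2F , (λ ()) , ≤-refl
third-vertex 0F 2F _   = 1F , (λ ()) , ≤-refl
third-vertex 0F 3F _   = 1F , (λ ()) , ≤-refl
third-vertex 1F 0F _   = 2F , (λ ()) , ≤-refl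
third-vertex 1F 1F v≢x = contradiction refl v≢x
third-vertex 1F 2F _   = 0F , (λ ()) , ≤-refl
third-vertex 1F 3F _   = 0F , (λ ()) , ≤-refl
third-vertex 2F 0F _   = 1F , (λ ()) , ≤-refl
third-vertex 2F 1F _   = 0F , (λ ()) , ≤-refl
third-vertex 2F 2F v≢x = contradiction refl v≢x
third-vertex 2F 3F _   = 0F , (λ ()) , ≤-refl
third-vertex 3F 0F _   = 1F , (λ ()) , ≤-refl
third-vertex 3F 1F _   = 0F , (λ ()) , ≤-refl
third-vertex 3F 2F _   = 0F , (λ ()) , ≤-refl
third-vertex 3F 3F v≢x = contradiction refl v≢x

avoids-none⇒third-vertex-avoids-few : (Δ : SimplicialComplex 4) (v x : Fin 4) → v ≢ x →
  IsFace Δ (⁅ v ⁆ ∪ ⁅ x ⁆) → avoidingCount Δ 2 v ≡ 0 →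
  Σ (Fin 4) λ u → u ≢ v × avoidingCount Δ 2 u ≤ 1
avoids-none⇒third-vertex-avoids-few Δ v x v≢x edge avoids-none with third-vertex v x v≢x
... | u , u≢v , few = u , u≢v , ≤-trans
  (length-filter-mono (isAntifacetAvoiding? Δ 2 u) (otherPairThrough? v x u) antifacet⇒other (allSubsets 4))
  few
  where
  antifacet⇒other : ∀ {F} → IsAntifacetAvoiding Δ 2 u F → OtherPairThrough v x u F
  antifacet⇒other {F} ((∣F∣≡2 , ¬face) , u∉F) with v ∈? F
  ... | yes v∈F = ∣F∣≡2 , v∈F , u∉F , λ { refl → ¬face edge }
  ... | no  v∉F = contradiction ((∣F∣≡2 , ¬face) , v∉F)
                    (length-filter≡0⇒¬ (isAntifacetAvoiding? Δ 2 v) (∈-allSubsets F) avoids-none)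

lemma3p1 : (n k : ℕ) (Δ : SimplicialComplex n) →
    HasDimPlusOne Δ k → Pure Δ →
    2 ≤ k → 2 ≤ n ∸ k →
    antifacetCount Δ k ≤ 2 * (n ∸ k) ∸ 1 →
    Σ (Fin n) λ v → Σ (Fin n) λ w → v ≢ w ×
      avoidingCount Δ k v ≤ 2 * (n ∸ k) ∸ 3 ×
      avoidingCount Δ k w ≤ 2 * (n ∸ k) ∸ 3
lemma3p1 zero    k _ _ _ _ 2≤c _ = contradiction (subst (2 ≤_) (0∸n≡0 k) 2≤c) λ ()
lemma3p1 (suc m) k Δ dim pure 2≤k 2≤c ē≤
  with twoAtMost⊎aboveExceptOne (avoidingCount Δ k) (2 * (suc m ∸ k) ∸ 3)
... | inj₁ two = two
... | inj₂ (v , others>)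
  with refl , refl , avoids-none ← tight-counting⇒n≡4∧k≡2 2≤k 2≤c ē≤
         (≤-trans (f[v]+n*m≤sum (avoidingCount Δ k) v others>) (≤-reflexive (sum-avoidingCount Δ k)))
  with x , v≢x , edge ← pure⇒edge-at Δ dim pure 2≤k v
  with u , u≢v , few ← avoids-none⇒third-vertex-avoids-few Δ v x v≢x edge avoids-none
  = contradiction few (<⇒≱ (others> u u≢v))
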